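{- Let $X=\mathrm{Fl}(a,b;n)$ and let $w$ be any 012-string for $X$. Then there exists a unique equivariant puzzle $P$ for $X$ with boundary $\triangle^{w,w}_w$, and this puzzle satisfies \[ \operatorname{weight}(P)=\prod_{i<j:\ w_i>w_j}(y_j-y_i)\in\Lambda=\mathbb{Z}[y_1,\dots,y_n]. \]
   Context: A 012-string for $X=\mathrm{Fl}(a,b;n)$ is a string of length $n$ with $a$ zeros, $b-a$ ones, $n-b$ twos. Labels are $0,\dots,7$; $0,1,2$ simple. Work in the plane tiled by unit equilateral triangles with a horizontal side. A triangular puzzle piece is a unit triangle whose labels, read counterclockwise, form a cyclic rotation of one of $(0,0,0),(1,1,1),(2,2,2),(3,0,1),(4,1,2),(5,0,2),(6,3,2),(7,0,4)$. A vertical equivariant puzzle piece is a unit rhombus with vertices at top, bottom, left, right whose two SW–NE sides carry label $p$ and whose two NW–SE sides carry label $q$, with $(p,q)\in\{(0,1),(1,2),(0,2),(3,2),(0,4),(3,4),(0,6),(7,2)\}$. An equivariant puzzle for $X$ with boundary $\triangle^{u,v}_w$ is a right-side-up triangle of side $n$ tiled by triangular pieces (any rotation) and vertical equivariant pieces with matching labels on shared edges, such that the labels on the left, right and bottom border segments, read left to right, are the 012-strings $u$, $v$, $w$. Numbering the bottom edges $1,\dots,n$ from the left, an equivariant piece has weight $y_j-y_i$ where $i$ (resp. $j$) is the bottom edge reached by following a line from the piece in south-west (resp. south-east) direction; $\operatorname{weight}(P)$ is the product of the weights of the equivariant pieces of $P$. -}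

module Defs where

open import Level using (0ℓ)
open import Data.Nat using (ℕ; zero; suc; _+_; _∸_; _<_; _≤_)
open import Data.Nat.Properties using (_<?_)
open import Data.Fin using (Fin; zero; suc; toℕ; inject≤)
import Data.Fin.Properties as FinP
open import Data.Vec using (Vec; []; _∷_; lookup)
open import Data.List using (List; []; _∷_; foldr; map; concatMap; upTo; allFin)
open import Data.List.Relation.Unary.Any using (Any)
open import Data.Maybe using (Maybe; just; nothing)
open import Data.Product using (_×_; _,_; Σ)
open import Data.Sum using (_⊎_)
open import Data.Bool using (if_then_else_; _∧_)
open import Relation.Nullary.Decidable using (⌊_⌋; does; yes; no)
open import Relation.Binary.PropositionalEquality using (_≡_)
open import Algebra.Bundles using (CommutativeRing)

Label : Set
Label = Fin 8

simple : Fin 3 → Label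
simple zero = zero
simple (suc zero) = suc zero
simple (suc (suc zero)) = suc (suc zero)

lab : ℕ → Label
lab 0 = zero
lab 1 = suc zero
lab 2 = suc (suc zero)
lab 3 = suc (suc (suc zero))
lab 4 = suc (suc (suc (suc zero)))
lab 5 = suc (suc (suc (suc (suc zero))))
lab 6 = suc (suc (suc (suc (suc (suc zero)))))
lab _ = suc (suc (suc (suc (suc (suc (suc zero))))))

occ : ∀ {n} → Fin 3 → Vec (Fin 3) n → ℕ
occ c [] = 0
occ c (x ∷ xs) = if does (c FinP.≟ x) then suc (occ c xs) else occ c xs

Is012 : (a b n : ℕ) → Vec (Fin 3) n → Set
Is012 a b n w = (occ zero w ≡ a) × (occ (suc zero) w ≡ b ∸ a) × (occ (suc (suc zero)) w ≡ n ∸ b)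

Triple : Set
Triple = Label × Label × Label

rot : Triple → Triple
rot (x , y , z) = (y , z , x)

-- the eight triangular pieces, labels read counterclockwise
triPieces : List Triple
triPieces =
  (lab 0 , lab 0 , lab 0) ∷ (lab 1 , lab 1 , lab 1) ∷ (lab 2 , lab 2 , lab 2) ∷
  (lab 3 , lab 0 , lab 1) ∷ (lab 4 , lab 1 , lab 2) ∷ (lab 5 , lab 0 , lab 2) ∷
  (lab 6 , lab 3 , lab 2) ∷ (lab 7 , lab 0 , lab 4) ∷ []

IsTriPiece : Triple → Set
IsTriPiece t = Any (λ s → t ≡ s ⊎ t ≡ rot s ⊎ t ≡ rot (rot s)) triPieces

-- vertical equivariant pieces: (p , q) = (SW–NE label , NW–SE label)
eqPieces : List (Label × Label)
eqPieces =
  (lab 0 , lab 1) ∷ (lab 1 , lab 2) ∷ (lab 0 , lab 2) ∷ (lab 3 , lab 2) ∷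
  (lab 0 , lab 4) ∷ (lab 3 , lab 4) ∷ (lab 0 , lab 6) ∷ (lab 7 , lab 2) ∷ []

IsEqPiece : Label × Label → Set
IsEqPiece pq = Any (pq ≡_) eqPieces

-- Lattice points i·e₁ + j·e₂ with e₁ = (1,0), e₂ = (1/2,√3/2);
-- the puzzle triangle has corners (0,0), (n,0), (0,n) (i,j ≥ 0, i+j ≤ n).
-- Unit edges, for i + j < n :
--   H i j : horizontal,          from (i,j)   to (i+1,j)
--   D i j : SW–NE direction,     from (i,j)   to (i,j+1)
--   A i j : NW–SE direction,     from (i+1,j) to (i,j+1)
-- Up triangle U i j (i+j < n): edges H i j, A i j, D i j (counterclockwise).
-- Down triangle V i j (i+j+1 < n): edges H i (j+1), A i j, D (i+1) j (ccw).
-- A vertical rhombus is U i (j+1) ∪ V i j (erasing H i (j+1)); its SW–NE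
-- sides are D i (j+1), D (i+1) j and its NW–SE sides are A i (j+1), A i j.
--
-- A filling records a label on every D and A edge and, on each horizontal
-- edge, either a label (just) or `nothing` meaning the edge is interior to
-- a vertical equivariant piece.  Values outside the triangle are ignored.

record Filling : Set where
  constructor filling
  field
    hl : ℕ → ℕ → Maybe Label
    dl : ℕ → ℕ → Label
    al : ℕ → ℕ → Label
open Filling public

UpOK : Filling → ℕ → ℕ → Set
UpOK P i j with hl P i j
... | just c  = IsTriPiece (c , al P i j , dl P i j)
... | nothing = Σ ℕ (λ j' → j ≡ suc j')   -- upper half of a rhombus

DownOK : Filling → ℕ → ℕ → Set
DownOK P i j with hl P i (suc j)
... | just c  = IsTriPiece (c , al P i j , dl P (suc i) j)
... | nothing = (dl P i (suc j) ≡ dl P (suc i) j) × (al P i (suc j) ≡ al P i j)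
              × IsEqPiece (dl P i (suc j) , al P i (suc j))

-- P is an equivariant puzzle for a triangle of side n with boundary
-- (left u, right v, bottom w), all read left to right
record IsPuzzle (n : ℕ) (u v w : Vec (Fin 3) n) (P : Filling) : Set where
  field
    up     : ∀ i j → i + j < n → UpOK P i j
    down   : ∀ i j → suc (i + j) < n → DownOK P i j
    left   : (k : Fin n) → dl P 0 (toℕ k) ≡ simple (lookup u k)
    right  : (k : Fin n) → al P (toℕ k) (n ∸ suc (toℕ k)) ≡ simple (lookup v k)
    bottom : (k : Fin n) → hl P (toℕ k) 0 ≡ just (simple (lookup w k))

SameOn : ℕ → Filling → Filling → Set
SameOn n P Q = ∀ i j → i + j < n →
  (hl P i j ≡ hl Q i j) × (dl P i j ≡ dl Q i j) × (al P i j ≡ al Q i j)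

-- An element of Λ = ℤ[y₁,…,yₙ] is determined by its images under
-- all evaluations yₖ ↦ ρ k in all commutative rings (universal property of
-- the polynomial ring), so we define weights as such evaluations.

module _ (R : CommutativeRing 0ℓ 0ℓ) where
  open CommutativeRing R using (Carrier; 0#; 1#) renaming (_+_ to _+R_; _*_ to _*R_; -_ to -R_)

  prod : List Carrier → Carrier
  prod = foldr _*R_ 1#

  -- extend an assignment Fin n → R to ℕ (0-based: index k ↦ y_{k+1})
  ext : ∀ {n} → (Fin n → Carrier) → ℕ → Carrier
  ext {zero}  ρ k       = 0#
  ext {suc n} ρ zero    = ρ zero
  ext {suc n} ρ (suc k) = ext (λ x → ρ (suc x)) k

  -- A rhombus centred at H i (j+1) reaches bottom edge i (0-based) going
  -- south-west and bottom edge i+j+1 going south-east: weight y_{i+j+2} - y_{i+1}.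
  pieceWeight : ∀ {n} → (Fin n → Carrier) → Filling → ℕ → ℕ → Carrier
  pieceWeight ρ P i zero = 1#
  pieceWeight {n} ρ P i (suc j) with hl P i (suc j) | i + suc j <? n
  ... | nothing | yes _ = ext ρ (i + suc j) +R (-R ext ρ i)
  ... | _       | _                      = 1#

  weight : ∀ n → (Fin n → Carrier) → Filling → Carrier
  weight n ρ P = prod (concatMap (λ i → map (λ j → pieceWeight ρ P i j) (upTo n)) (upTo n))

  inversionProduct : ∀ n → (Fin n → Carrier) → Vec (Fin 3) n → Carrier
  inversionProduct n ρ w =
    prod (concatMap (λ i → map (λ j →
      if ⌊ i Data.Fin.<? j ⌋ ∧ ⌊ lookup w j Data.Fin.<? lookup w i ⌋
      then ρ j +R (-R ρ i) else 1#) (allFin n)) (allFin n))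

module Submission where

-- The canonical puzzle carries w_i on every A-edge of the strip above bottom
-- edge i and w_k on every D-edge of the north-west path from bottom edge k;
-- where the paths of i < k cross there is a rhombus exactly when w_k < w_i, so
-- its rhombi sit at the inversions of w, which gives the weight.  For
-- uniqueness, an arbitrary puzzle Q first has only simple labels on its A- and
-- D-edges, by a discrete Green's theorem: for charges balanced on every
-- triangular piece, the charge entering a strip through its bottom and left
-- side leaves through its top and right side, and comparing with the boundary
-- leaves no room for non-simple labels.  With simple labels, finitely many local
-- rules then force Q, cell by cell and strip by strip from the left, to be the
-- canonical puzzle.

open import Defs
open import Level using (0ℓ)
open import Function using (id)
open import Data.Nat as ℕ using (ℕ; zero; suc; _+_; _*_; _∸_; _≤_; _<_; z≤n; s≤s)
open import Data.Nat.Properties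
  using ( _<?_; +-suc; +-identityʳ; +-assoc; +-comm; +-cancelˡ-≡; m+n≡0⇒m≡0; m+n≡0⇒n≡0
        ; m<n⇒m<1+n; n<1+n; m<1+n⇒m<n∨m≡n; <⇒≤; ≤-reflexive; ≤-trans; ≤-<-trans; <-≤-trans
        ; m≤m+n; m<m+n; m+n∸m≡n; m+n≤o⇒m≤o∸n; m+[n∸m]≡n; <-irrefl; <⇒≯; ≤⇒≯ )
open import Data.Nat.Tactic.RingSolver using (solve-∀)
open import Data.Fin as F using (Fin; zero; suc; toℕ; fromℕ<)
import Data.Fin.Properties as FinP
open import Data.Vec using (Vec; []; _∷_; lookup)
open import Data.List using (List; []; _∷_; _++_; map; concatMap; applyUpTo; upTo; tabulate; allFin)
open import Data.List.Properties using (map-applyUpTo; map-tabulate)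
open import Data.List.Relation.Unary.Any using (any?)
import Data.List.Relation.Unary.Any as Any
open import Data.Maybe using (Maybe; just; nothing)
import Data.Maybe.Properties as MaybeP
open import Data.Product using (Σ; _×_; _,_; proj₁; proj₂)
import Data.Product.Properties as ProdP
open import Data.Sum using (inj₁; inj₂)
open import Data.Bool using (_∧_; if_then_else_)
open import Relation.Nullary using (Dec; yes; no; ¬_; contradiction)
open import Relation.Nullary.Decidable using (⌊_⌋; from-yes; _×-dec_; _→-dec_; _⊎-dec_)
open import Relation.Binary.Definitions using (DecidableEquality)
open import Relation.Binary.PropositionalEquality
  using (_≡_; refl; sym; trans; cong; cong₂; subst; subst₂; module ≡-Reasoning)
open import Algebra.Bundles using (CommutativeRing)

-- Deciding membership in the piece lists turns every statement about finitely
-- many labels into a closed computation, checked below with `from-yes`.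

_≟T_ : DecidableEquality Triple
_≟T_ = ProdP.≡-dec FinP._≟_ (ProdP.≡-dec FinP._≟_ FinP._≟_)

isTriPiece? : ∀ t → Dec (IsTriPiece t)
isTriPiece? t = any? (λ s → (t ≟T s) ⊎-dec (t ≟T rot s) ⊎-dec (t ≟T rot (rot s))) triPieces

isEqPiece? : ∀ pq → Dec (IsEqPiece pq)
isEqPiece? pq = any? (ProdP.≡-dec FinP._≟_ FinP._≟_ pq) eqPieces

rot-piece : ∀ {t} → IsTriPiece t → IsTriPiece (rot t)
rot-piece = Any.map λ { (inj₁ refl) → inj₂ (inj₁ refl)
                      ; (inj₂ (inj₁ refl)) → inj₂ (inj₂ refl)
                      ; (inj₂ (inj₂ refl)) → inj₁ refl }

IsSimple : Label → Set
IsSimple l = Σ (Fin 3) (λ a → l ≡ simple a)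

isSimple? : ∀ l → Dec (IsSimple l)
isSimple? l = FinP.any? (λ a → l FinP.≟ simple a)

-- Every triangular piece (x , y , z),
-- read counterclockwise, has total charge  α x + σ y + γ z = 4, and the charge σ
-- is at most 2 with equality exactly on the simple labels.
α σ γ : Label → ℕ
α l = lookup (0 ∷ 1 ∷ 2 ∷ 1 ∷ 2 ∷ 2 ∷ 3 ∷ 1 ∷ []) l
σ l = lookup (2 ∷ 2 ∷ 2 ∷ 1 ∷ 1 ∷ 0 ∷ 0 ∷ 0 ∷ []) l
γ l = lookup (2 ∷ 1 ∷ 0 ∷ 2 ∷ 1 ∷ 2 ∷ 1 ∷ 3 ∷ []) l

charge-law : ∀ {x y z} → IsTriPiece (x , y , z) → α x + σ y + γ z ≡ 4
charge-law {x} {y} {z} = from-yes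
  (FinP.all? λ x → FinP.all? λ y → FinP.all? λ z →
     isTriPiece? (x , y , z) →-dec (α x + σ y + γ z ℕ.≟ 4)) x y z

charge-law′ : ∀ {x y z} → IsTriPiece (x , y , z) → γ x + α y + σ z ≡ 4
charge-law′ {x} {y} {z} t = begin
  γ x + α y + σ z   ≡⟨ +-assoc (γ x) (α y) (σ z) ⟩
  γ x + (α y + σ z) ≡⟨ +-comm (γ x) (α y + σ z) ⟩
  α y + σ z + γ x   ≡⟨ charge-law (rot-piece t) ⟩
  4                 ∎
  where open ≡-Reasoning

defect : Label → ℕ
defect l = 2 ∸ σ l

σ+defect : ∀ l → σ l + defect l ≡ 2
σ+defect = from-yes (FinP.all? λ l → σ l + defect l ℕ.≟ 2)

defect-simple : ∀ l → defect l ≡ 0 → IsSimple l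
defect-simple = from-yes (FinP.all? λ l → (defect l ℕ.≟ 0) →-dec isSimple? l)

σ-simple : ∀ a → σ (simple a) ≡ 2
σ-simple = from-yes (FinP.all? λ a → σ (simple a) ℕ.≟ 2)

-- The horizontal edge where the A-labels of a letter a meet the D-labels of a
-- later letter d: if d < a the two cells there form a rhombus (`nothing`),
-- otherwise the edge carries the label `meet a d`.
meet : Fin 3 → Fin 3 → Label
meet zero (suc zero) = lab 3
meet (suc zero) (suc (suc zero)) = lab 4
meet zero (suc (suc zero)) = lab 5
meet a _ = simple a

crossing : Fin 3 → Fin 3 → Maybe Label
crossing a d with d F.<? a
... | yes _ = nothing
... | no _  = just (meet a d)

_≟M_ : DecidableEquality (Maybe Label)
_≟M_ = MaybeP.≡-dec FinP._≟_

diagonal-piece : ∀ a → IsTriPiece (simple a , simple a , simple a)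
diagonal-piece = from-yes (FinP.all? λ a → isTriPiece? (simple a , simple a , simple a))

crossing-piece : ∀ a d h → crossing a d ≡ just h → IsTriPiece (h , simple a , simple d)
crossing-piece = from-yes (FinP.all? λ a → FinP.all? λ d → FinP.all? λ h →
  (crossing a d ≟M just h) →-dec isTriPiece? (h , simple a , simple d))

crossing-rhombus : ∀ a d → crossing a d ≡ nothing → IsEqPiece (simple d , simple a)
crossing-rhombus = from-yes (FinP.all? λ a → FinP.all? λ d →
  (crossing a d ≟M nothing) →-dec isEqPiece? (simple d , simple a))

bottom-rule : ∀ a y → IsTriPiece (simple a , simple y , simple a) → y ≡ a
bottom-rule = from-yes (FinP.all? λ a → FinP.all? λ y →
  isTriPiece? (simple a , simple y , simple a) →-dec y FinP.≟ a)

crossing-rule : ∀ a d x y h →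
  IsTriPiece (h , simple a , simple x) → IsTriPiece (h , simple y , simple d) →
  x ≡ d × y ≡ a × crossing a d ≡ just h
crossing-rule = from-yes (FinP.all? λ a → FinP.all? λ d → FinP.all? λ x → FinP.all? λ y → FinP.all? λ h →
  isTriPiece? (h , simple a , simple x) →-dec isTriPiece? (h , simple y , simple d) →-dec
  (x FinP.≟ d ×-dec y FinP.≟ a ×-dec crossing a d ≟M just h))

rhombus-rule : ∀ a d → IsEqPiece (simple d , simple a) → crossing a d ≡ nothing
rhombus-rule = from-yes (FinP.all? λ a → FinP.all? λ d →
  isEqPiece? (simple d , simple a) →-dec crossing a d ≟M nothing)

-- The k-th letter of a string, indexed by ℕ.
letter : ∀ {n} → Vec (Fin 3) n → ℕ → Fin 3
letter []       _       = zero
letter (x ∷ xs) zero    = x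
letter (x ∷ xs) (suc k) = letter xs k

letter-toℕ : ∀ {n} (w : Vec (Fin 3) n) (k : Fin n) → letter w (toℕ k) ≡ lookup w k
letter-toℕ (x ∷ xs) zero    = refl
letter-toℕ (x ∷ xs) (suc k) = letter-toℕ xs k

label : ∀ {n} → Vec (Fin 3) n → ℕ → Label
label w k = simple (letter w k)

at-ℕ : ∀ {n} {P : ℕ → Set} → (∀ (k : Fin n) → P (toℕ k)) → ∀ i → i < n → P i
at-ℕ {P = P} h i i<n = subst P (FinP.toℕ-fromℕ< i<n) (h (fromℕ< i<n))

-- The upper cell over H i (j+1) lies inside the triangle when the lower one does.
suc-inside : ∀ {i j n} → suc (i + j) < n → i + suc j < n
suc-inside {i} {j} {n} = subst (_< n) (sym (+-suc i j))

-- The letter w_i travels from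
-- bottom edge i north-east, labelling the A-edges A i j of strip i; the letter
-- w_k travels north-west, labelling the D-edges D i j with i + j = k.  The paths
-- of positions i < k cross at the horizontal edge H i (k - i), which lies inside
-- a rhombus exactly when w_k < w_i, i.e. at an inversion of w.
module Canonical {n} (w : Vec (Fin 3) n) where

  canonicalH : ℕ → ℕ → Maybe Label
  canonicalH i zero    = just (label w i)
  canonicalH i (suc j) = crossing (letter w i) (letter w (i + suc j))

  canonical : Filling
  canonical = filling canonicalH (λ i j → label w (i + j)) (λ i j → label w i)

  canonical-up : ∀ i j → i + j < n → UpOK canonical i j
  canonical-up i zero    _ rewrite +-identityʳ i = diagonal-piece (letter w i)
  canonical-up i (suc j) _ with crossing (letter w i) (letter w (i + suc j)) in eq
  ... | nothing = j , refl
  ... | just h  = crossing-piece _ _ h eq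

  canonical-down : ∀ i j → suc (i + j) < n → DownOK canonical i j
  canonical-down i j _ with crossing (letter w i) (letter w (i + suc j)) in eq
  ... | nothing = cong (label w) (+-suc i j) , refl , crossing-rhombus _ _ eq
  ... | just h  = subst (λ k → IsTriPiece (h , label w i , label w k)) (+-suc i j) (crossing-piece _ _ h eq)

  canonical-isPuzzle : IsPuzzle n w w w canonical
  canonical-isPuzzle = record
    { up     = canonical-up
    ; down   = canonical-down
    ; left   = λ k → cong simple (letter-toℕ w k)
    ; right  = λ k → cong simple (letter-toℕ w k)
    ; bottom = λ k → cong (λ a → just (simple a)) (letter-toℕ w k)
    }

Σ< : ℕ → (ℕ → ℕ) → ℕ
Σ< zero    f = 0
Σ< (suc q) f = Σ< q f + f q

Σ<-cong : ∀ {f g} q → (∀ k → k < q → f k ≡ g k) → Σ< q f ≡ Σ< q g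
Σ<-cong zero    _  = refl
Σ<-cong (suc q) eq = cong₂ _+_ (Σ<-cong q (λ k k<q → eq k (m<n⇒m<1+n k<q))) (eq q (n<1+n q))

Σ<-head : ∀ f q → Σ< (suc q) f ≡ f 0 + Σ< q (λ k → f (suc k))
Σ<-head f zero    = sym (+-identityʳ (f 0))
Σ<-head f (suc q) = trans (cong (_+ f (suc q)) (Σ<-head f q)) (+-assoc (f 0) _ (f (suc q)))

Σ<-+ : ∀ f g q → Σ< q (λ k → f k + g k) ≡ Σ< q f + Σ< q g
Σ<-+ f g zero    = refl
Σ<-+ f g (suc q) = trans (cong (_+ (f q + g q)) (Σ<-+ f g q)) (regroup (Σ< q f) (Σ< q g) (f q) (g q))
  where
  regroup : ∀ a b c d → (a + b) + (c + d) ≡ (a + c) + (b + d)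
  regroup = solve-∀

Σ<-const : ∀ c q → Σ< q (λ _ → c) ≡ q * c
Σ<-const c zero    = refl
Σ<-const c (suc q) = trans (cong (_+ c) (Σ<-const c q)) (+-comm (q * c) c)

Σ<-zero : ∀ f q → Σ< q f ≡ 0 → ∀ k → k < q → f k ≡ 0
Σ<-zero f (suc q) sum≡0 k k<1+q with m<1+n⇒m<n∨m≡n k<1+q
... | inj₁ k<q  = Σ<-zero f q (m+n≡0⇒m≡0 (Σ< q f) sum≡0) k k<q
... | inj₂ refl = m+n≡0⇒n≡0 (Σ< q f) sum≡0

module Boundary {n} {u v w : Vec (Fin 3) n} {Q : Filling} (pz : IsPuzzle n u v w Q) where
  open IsPuzzle pz

  bottom-ℕ : ∀ i → i < n → hl Q i 0 ≡ just (label w i)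
  bottom-ℕ = at-ℕ λ k → trans (bottom k) (cong (λ a → just (simple a)) (sym (letter-toℕ w k)))

  left-ℕ : ∀ i → i < n → dl Q 0 i ≡ label u i
  left-ℕ = at-ℕ λ k → trans (left k) (cong simple (sym (letter-toℕ u k)))

  right-ℕ : ∀ i → i < n → al Q i (n ∸ suc i) ≡ label v i
  right-ℕ = at-ℕ λ k → trans (right k) (cong simple (sym (letter-toℕ v k)))

-- Fix charges for which every triangular
-- piece has total charge 4.  Consecutive cells of the strip between the D-lines
-- i and i+1 (the lines of the edges D i k and D (i+1) k) pass on the same charge,
-- so the A-edge at height p together with the first p+1 edges of the left side
-- balances the bottom edge together with the first p edges of the right side.
module StripBalance {n} {u v w : Vec (Fin 3) n} {Q : Filling} (pz : IsPuzzle n u v w Q)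
    (αH αA αD : Label → ℕ)
    (law : ∀ {h a d} → IsTriPiece (h , a , d) → αH h + αA a + αD d ≡ 4) where
  open IsPuzzle pz
  open Boundary pz

  law′ : ∀ {h a d} → IsTriPiece (h , a , d) → αH h + (αA a + αD d) ≡ 4
  law′ {h} {a} {d} t = trans (sym (+-assoc (αH h) (αA a) (αD d))) (law t)

  exchange : ∀ i j → suc (i + j) < n →
    αA (al Q i j) + αD (dl Q (suc i) j) ≡ αA (al Q i (suc j)) + αD (dl Q i (suc j))
  exchange i j h with hl Q i (suc j) | down i j h | up i (suc j) (suc-inside h)
  ... | just c  | below     | above = +-cancelˡ-≡ (αH c) _ _ (trans (law′ below) (sym (law′ above)))
  ... | nothing | D≡ , A≡ , _ | _   rewrite D≡ | A≡ = refl

  -- The bottom cell of strip i balances like the piece (w_i , w_i , w_i).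
  base-cell : ∀ i → i < n → αA (al Q i 0) + αD (dl Q i 0) ≡ αA (label w i) + αD (label w i)
  base-cell i i<n with hl Q i 0 | up i 0 (subst (_< n) (sym (+-identityʳ i)) i<n) | bottom-ℕ i i<n
  ... | just _ | cell | refl =
    +-cancelˡ-≡ (αH (label w i)) _ _ (trans (law′ cell) (sym (law′ (diagonal-piece (letter w i)))))

  column : ℕ → ℕ → ℕ
  column i q = Σ< q (λ k → αD (dl Q i k))

  strip-balance : ∀ i p → i + p < n →
    αA (al Q i p) + column i (suc p) ≡ (αA (label w i) + αD (label w i)) + column (suc i) p
  strip-balance i zero h =
    trans (base-cell i (subst (_< n) (+-identityʳ i) h)) (sym (+-identityʳ _))
  strip-balance i (suc p) h = +-cancelˡ-≡ (αA (al Q i p)) _ _ (begin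
      A₀ + (A₁ + (column i (suc p) + Y))              ≡⟨ regroup₁ A₀ A₁ _ Y ⟩
      (A₁ + Y) + (A₀ + column i (suc p))              ≡⟨ cong₂ _+_ (sym (exchange i p h′)) (strip-balance i p (<⇒≤ h′)) ⟩
      (A₀ + X) + (κ + column (suc i) p)               ≡⟨ regroup₂ A₀ X κ _ ⟩
      A₀ + (κ + (column (suc i) p + X))               ∎)
    where
    open ≡-Reasoning
    h′ : suc (i + p) < n
    h′ = subst (_< n) (+-suc i p) h
    A₀ A₁ X Y κ : ℕ
    A₀ = αA (al Q i p)
    A₁ = αA (al Q i (suc p))
    X  = αD (dl Q (suc i) p)
    Y  = αD (dl Q i (suc p))
    κ  = αA (label w i) + αD (label w i)
    regroup₁ : ∀ a₀ a₁ c y → a₀ + (a₁ + (c + y)) ≡ (a₁ + y) + (a₀ + c)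
    regroup₁ = solve-∀
    regroup₂ : ∀ a₀ x k c → (a₀ + x) + (k + c) ≡ a₀ + (k + (c + x))
    regroup₂ = solve-∀

module Rigidity {n} (w : Vec (Fin 3) n) (Q : Filling) (pz : IsPuzzle n w w w Q) where
  open IsPuzzle pz
  open Boundary pz
  open Canonical w

  -- Balancing the charges (α , σ , γ), each strip passes on
  -- the γ-charge of its bottom letter plus the defect of its top A-edge; on the
  -- left boundary the γ-charge is that of the letters, so no defect can occur.
  module Balance₁ = StripBalance pz α σ γ charge-law

  letterCharge : ℕ → ℕ → ℕ
  letterCharge i q = Σ< q (λ k → γ (label w (i + k)))

  letterCharge-step : ∀ i p → letterCharge i (suc p) ≡ γ (label w i) + letterCharge (suc i) p
  letterCharge-step i p = trans (Σ<-head _ p)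
    (cong₂ _+_ (cong (λ m → γ (label w m)) (+-identityʳ i))
               (Σ<-cong p (λ k _ → cong (λ m → γ (label w m)) (+-suc i k))))

  -- Total defect of the A-edges A i (q-1), A (i+1) (q-2), … , A (i+q-1) 0.
  defects : ℕ → ℕ → ℕ
  defects i zero    = 0
  defects i (suc p) = defect (al Q i p) + defects (suc i) p

  column-excess : ∀ q i → i + q ≤ n → Balance₁.column i q ≡ letterCharge i q + defects i q
  column-excess zero    i _ = refl
  column-excess (suc p) i h = +-cancelˡ-≡ (σ A) _ _ (begin
      σ A + Balance₁.column i (suc p)
        ≡⟨ Balance₁.strip-balance i p (subst (_≤ n) (+-suc i p) h) ⟩
      (σ (label w i) + γ (label w i)) + Balance₁.column (suc i) p
        ≡⟨ cong₂ (λ s c → (s + γ (label w i)) + c) (trans (σ-simple (letter w i)) (sym (σ+defect A)))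
                 (column-excess p (suc i) (subst (_≤ n) (+-suc i p) h)) ⟩
      ((σ A + defect A) + γ (label w i)) + (letterCharge (suc i) p + defects (suc i) p)
        ≡⟨ regroup (σ A) (defect A) (γ (label w i)) _ _ ⟩
      σ A + ((γ (label w i) + letterCharge (suc i) p) + (defect A + defects (suc i) p))
        ≡⟨ cong (λ c → σ A + (c + defects i (suc p))) (sym (letterCharge-step i p)) ⟩
      σ A + (letterCharge i (suc p) + defects i (suc p)) ∎)
    where
    open ≡-Reasoning
    A : Label
    A = al Q i p
    regroup : ∀ s e g c d → ((s + e) + g) + (c + d) ≡ s + ((g + c) + (e + d))
    regroup = solve-∀

  defect-on-antidiagonal : ∀ d i j → defects i (suc (d + j)) ≡ 0 → defect (al Q (i + d) j) ≡ 0
  defect-on-antidiagonal zero    i j none rewrite +-identityʳ i = m+n≡0⇒m≡0 _ none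
  defect-on-antidiagonal (suc d) i j none rewrite +-suc i d =
    defect-on-antidiagonal d (suc i) j (m+n≡0⇒n≡0 (defect (al Q i (suc (d + j)))) none)

  A-simple : ∀ i j → i + j < n → IsSimple (al Q i j)
  A-simple i j h = defect-simple _ (defect-on-antidiagonal i 0 j no-defects)
    where
    q : ℕ
    q = suc (i + j)
    left-column : Balance₁.column 0 q ≡ letterCharge 0 q
    left-column = Σ<-cong q (λ k k<q → cong γ (left-ℕ k (<-≤-trans k<q h)))
    no-defects : defects 0 q ≡ 0
    no-defects = +-cancelˡ-≡ (letterCharge 0 q) _ 0
      (trans (sym (column-excess q 0 h)) (trans left-column (sym (+-identityʳ _))))

  -- D-edges are simple.  Balancing the rotated charges (γ , α , σ), every D-line
  -- carries the maximal σ-charge 2 per edge, because the top A-edge of each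
  -- strip lies on the right boundary.
  module Balance₂ = StripBalance pz γ α σ charge-law′

  column-full : ∀ m i → i + m ≡ n → Balance₂.column i m ≡ m * 2
  column-full zero    i _ = refl
  column-full (suc p) i e = +-cancelˡ-≡ (α (label w i)) _ _ (begin
      α (label w i) + Balance₂.column i (suc p)
        ≡⟨ cong (λ l → α l + Balance₂.column i (suc p)) (sym top-edge) ⟩
      α (al Q i p) + Balance₂.column i (suc p)
        ≡⟨ Balance₂.strip-balance i p i+p<n ⟩
      (α (label w i) + σ (label w i)) + Balance₂.column (suc i) p
        ≡⟨ cong₂ (λ s c → (α (label w i) + s) + c) (σ-simple (letter w i))
                 (column-full p (suc i) (trans (sym (+-suc i p)) e)) ⟩
      (α (label w i) + 2) + p * 2
        ≡⟨ +-assoc (α (label w i)) 2 (p * 2) ⟩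
      α (label w i) + suc p * 2 ∎)
    where
    open ≡-Reasoning
    i+p<n : i + p < n
    i+p<n = subst (_≤ n) (+-suc i p) (≤-reflexive e)
    height : n ∸ suc i ≡ p
    height = trans (cong (_∸ suc i) (trans (sym e) (+-suc i p))) (m+n∸m≡n (suc i) p)
    top-edge : al Q i p ≡ label w i
    top-edge = subst (λ k → al Q i k ≡ label w i) height (right-ℕ i (≤-<-trans (m≤m+n i p) i+p<n))

  D-simple : ∀ i k → i + k < n → IsSimple (dl Q i k)
  D-simple i k h = defect-simple _ (Σ<-zero (λ k → defect (dl Q i k)) m no-defects k k<m)
    where
    i≤n : i ≤ n
    i≤n = ≤-trans (m≤m+n i k) (<⇒≤ h)
    m : ℕ
    m = n ∸ i
    k<m : k < m
    k<m = m+n≤o⇒m≤o∸n (suc k) (subst (_≤ n) (cong suc (+-comm i k)) h)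
    full : Σ< m (λ k → σ (dl Q i k) + defect (dl Q i k)) ≡ m * 2
    full = trans (Σ<-cong m (λ k _ → σ+defect (dl Q i k))) (Σ<-const 2 m)
    no-defects : Σ< m (λ k → defect (dl Q i k)) ≡ 0
    no-defects = +-cancelˡ-≡ (Balance₂.column i m) _ 0 (begin
      Balance₂.column i m + Σ< m (λ k → defect (dl Q i k))  ≡⟨ sym (Σ<-+ _ _ m) ⟩
      Σ< m (λ k → σ (dl Q i k) + defect (dl Q i k))         ≡⟨ full ⟩
      m * 2                                                 ≡⟨ sym (column-full m i (m+[n∸m]≡n i≤n)) ⟩
      Balance₂.column i m                                   ≡⟨ sym (+-identityʳ _) ⟩
      Balance₂.column i m + 0                               ∎)
      where open ≡-Reasoning

  cross-step : ∀ i j → suc (i + j) < n → al Q i j ≡ label w i → dl Q i (suc j) ≡ label w (i + suc j) →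
    hl Q i (suc j) ≡ canonicalH i (suc j) × al Q i (suc j) ≡ label w i × dl Q (suc i) j ≡ label w (i + suc j)
  cross-step i j h A≡ D≡ with hl Q i (suc j) | down i j h | up i (suc j) (suc-inside h)
  ... | just c | below | above =
    sym (proj₂ (proj₂ forced)) ,
    trans (proj₂ y-simple) (cong simple (proj₁ (proj₂ forced))) ,
    trans (proj₂ x-simple) (cong simple (proj₁ forced))
    where
    x-simple : IsSimple (dl Q (suc i) j)
    x-simple = D-simple (suc i) j h
    y-simple : IsSimple (al Q i (suc j))
    y-simple = A-simple i (suc j) (suc-inside h)
    forced : proj₁ x-simple ≡ letter w (i + suc j) × proj₁ y-simple ≡ letter w i
           × crossing (letter w i) (letter w (i + suc j)) ≡ just c
    forced = crossing-rule (letter w i) (letter w (i + suc j)) (proj₁ x-simple) (proj₁ y-simple) c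
      (subst₂ (λ a d → IsTriPiece (c , a , d)) A≡ (proj₂ x-simple) below)
      (subst₂ (λ a d → IsTriPiece (c , a , d)) (proj₂ y-simple) D≡ above)
  ... | nothing | D= , A= , piece | _ =
    sym (rhombus-rule (letter w i) (letter w (i + suc j)) (subst₂ (λ d a → IsEqPiece (d , a)) D≡ (trans A= A≡) piece)) ,
    trans A= A≡ , trans (sym D=) D≡

  column-A : ∀ i → (∀ j → i + j < n → dl Q i j ≡ label w (i + j)) → ∀ j → i + j < n → al Q i j ≡ label w i
  column-A i D≡ zero h with hl Q i 0 | up i 0 h | bottom-ℕ i (subst (_< n) (+-identityʳ i) h)
  ... | just _ | cell | refl =
    trans (proj₂ y-simple) (cong simple (bottom-rule (letter w i) (proj₁ y-simple)
      (subst₂ (λ a d → IsTriPiece (label w i , a , d)) (proj₂ y-simple)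
              (trans (D≡ 0 h) (cong (label w) (+-identityʳ i))) cell)))
    where
    y-simple : IsSimple (al Q i 0)
    y-simple = A-simple i 0 h
  column-A i D≡ (suc j) h =
    proj₁ (proj₂ (cross-step i j h′ (column-A i D≡ j (<⇒≤ h′)) (D≡ (suc j) h)))
    where h′ : suc (i + j) < n
          h′ = subst (_< n) (+-suc i j) h

  column-D : ∀ i j → i + j < n → dl Q i j ≡ label w (i + j)
  column-D zero    j h = left-ℕ j h
  column-D (suc i) j h = trans
    (proj₂ (proj₂ (cross-step i j h (column-A i (column-D i) j (<⇒≤ h)) (column-D i (suc j) (suc-inside h)))))
    (cong (label w) (+-suc i j))

  horizontal : ∀ i j → i + j < n → hl Q i j ≡ canonicalH i j
  horizontal i zero    h = bottom-ℕ i (subst (_< n) (+-identityʳ i) h)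
  horizontal i (suc j) h =
    proj₁ (cross-step i j h′ (column-A i (column-D i) j (<⇒≤ h′)) (column-D i (suc j) h))
    where h′ : suc (i + j) < n
          h′ = subst (_< n) (+-suc i j) h

  canonical-unique : SameOn n canonical Q
  canonical-unique i j h = sym (horizontal i j h) , sym (column-D i j h) , sym (column-A i (column-D i) j h)

module Weights (R : CommutativeRing 0ℓ 0ℓ) where
  open CommutativeRing R using (Carrier; 1#; _≈_; setoid; reflexive; *-cong; *-assoc; *-identityˡ)
    renaming (_+_ to _+R_; -_ to -R_; _*_ to _*R_; refl to ≈-refl; sym to ≈-sym; trans to ≈-trans)
  open import Relation.Binary.Reasoning.Setoid setoid

  ∏< : ℕ → (ℕ → Carrier) → Carrier
  ∏< m H = prod R (applyUpTo H m)

  ∏<-cong : ∀ {H H′} m → (∀ k → H k ≈ H′ k) → ∏< m H ≈ ∏< m H′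
  ∏<-cong zero    _  = ≈-refl
  ∏<-cong (suc m) eq = *-cong (eq 0) (∏<-cong m (λ k → eq (suc k)))

  ∏<-ones : ∀ {H} m → (∀ k → k < m → H k ≈ 1#) → ∏< m H ≈ 1#
  ∏<-ones zero    _    = ≈-refl
  ∏<-ones (suc m) ones =
    ≈-trans (*-cong (ones 0 (s≤s z≤n)) (∏<-ones m (λ k k<m → ones (suc k) (s≤s k<m)))) (*-identityˡ 1#)

  ∏<-dropˡ : ∀ m l H → (∀ k → k < m → H k ≈ 1#) → ∏< (m + l) H ≈ ∏< l (λ k → H (m + k))
  ∏<-dropˡ zero    l H _    = ≈-refl
  ∏<-dropˡ (suc m) l H ones = ≈-trans (*-cong (ones 0 (s≤s z≤n)) ≈-refl)
    (≈-trans (*-identityˡ _) (∏<-dropˡ m l (λ k → H (suc k)) (λ k k<m → ones (suc k) (s≤s k<m))))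

  ∏<-dropʳ : ∀ l m H → (∀ k → l ≤ k → H k ≈ 1#) → ∏< (l + m) H ≈ ∏< l H
  ∏<-dropʳ zero    m H ones = ∏<-ones m (λ k _ → ones k z≤n)
  ∏<-dropʳ (suc l) m H ones = *-cong ≈-refl (∏<-dropʳ l m (λ k → H (suc k)) (λ k l≤k → ones (suc k) (s≤s l≤k)))

  ∏<-shift : ∀ i n H → (∀ k → k < i → H k ≈ 1#) → (∀ k → n ≤ k → H k ≈ 1#) →
    ∏< n (λ j → H (i + j)) ≈ ∏< n H
  ∏<-shift i n H below above = begin
    ∏< n (λ j → H (i + j)) ≈⟨ ≈-sym (∏<-dropˡ i n H below) ⟩
    ∏< (i + n) H           ≡⟨ cong (λ m → ∏< m H) (+-comm i n) ⟩
    ∏< (n + i) H           ≈⟨ ∏<-dropʳ n i H above ⟩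
    ∏< n H                 ∎

  prod-++ : ∀ xs ys → prod R (xs ++ ys) ≈ prod R xs *R prod R ys
  prod-++ []       ys = ≈-sym (*-identityˡ _)
  prod-++ (x ∷ xs) ys = ≈-trans (*-cong ≈-refl (prod-++ xs ys)) (≈-sym (*-assoc x _ _))

  prod-concatMap : ∀ {A : Set} (f : A → List Carrier) xs →
    prod R (concatMap f xs) ≈ prod R (map (λ x → prod R (f x)) xs)
  prod-concatMap f []       = ≈-refl
  prod-concatMap f (x ∷ xs) = ≈-trans (prod-++ (f x) (concatMap f xs)) (*-cong ≈-refl (prod-concatMap f xs))

  prod-upTo : ∀ m (F : ℕ → Carrier) → prod R (map F (upTo m)) ≡ ∏< m F
  prod-upTo m F = cong (prod R) (map-applyUpTo id F m)

  prod-tabulate : ∀ {m} (F : Fin m → Carrier) (H : ℕ → Carrier) →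
    (∀ k → F k ≈ H (toℕ k)) → prod R (tabulate F) ≈ ∏< m H
  prod-tabulate {zero}  F H eq = ≈-refl
  prod-tabulate {suc m} F H eq = *-cong (eq zero) (prod-tabulate (λ k → F (suc k)) (λ k → H (suc k)) (λ k → eq (suc k)))

  prod-allFin : ∀ {m} (F : Fin m → Carrier) (H : ℕ → Carrier) →
    (∀ k → F k ≈ H (toℕ k)) → prod R (map F (allFin m)) ≈ ∏< m H
  prod-allFin F H eq = ≈-trans (reflexive (cong (prod R) (map-tabulate id F))) (prod-tabulate F H eq)

  ext-toℕ : ∀ {n} (ρ : Fin n → Carrier) (k : Fin n) → ext R ρ (toℕ k) ≡ ρ k
  ext-toℕ ρ zero    = refl
  ext-toℕ ρ (suc k) = ext-toℕ (λ x → ρ (suc x)) k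

  module CanonicalWeight {n} (w : Vec (Fin 3) n) (ρ : Fin n → Carrier) where
    open Canonical w

    inversionFactor : ℕ → ℕ → Carrier
    inversionFactor i k = if ⌊ k <? n ⌋ ∧ ⌊ i <? k ⌋ ∧ ⌊ letter w k F.<? letter w i ⌋
                          then ext R ρ k +R (-R ext R ρ i) else 1#

    factor-beyond : ∀ i k → ¬ k < n → inversionFactor i k ≡ 1#
    factor-beyond i k k≮n with k <? n
    ... | yes k<n = contradiction k<n k≮n
    ... | no _    = refl

    factor-below : ∀ i k → ¬ i < k → inversionFactor i k ≡ 1#
    factor-below i k i≮k with k <? n | i <? k
    ... | _      | yes i<k = contradiction i<k i≮k
    ... | yes _  | no _    = refl
    ... | no _   | no _    = refl

    canonical-factor : ∀ i j → pieceWeight R ρ canonical i j ≈ inversionFactor i (i + j)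
    canonical-factor i zero = reflexive (sym (factor-below i (i + 0) (<-irrefl (sym (+-identityʳ i)))))
    canonical-factor i (suc j) with letter w (i + suc j) F.<? letter w i | i + suc j <? n | i <? i + suc j
    ... | _     | _     | no i≮ = contradiction (m<m+n i (s≤s z≤n)) i≮
    ... | yes _ | yes _ | yes _ = ≈-refl
    ... | yes _ | no _  | yes _ = ≈-refl
    ... | no _  | yes _ | yes _ = ≈-refl
    ... | no _  | no _  | yes _ = ≈-refl

    inversionTerm : Fin n → Fin n → Carrier
    inversionTerm i k = if ⌊ i F.<? k ⌋ ∧ ⌊ lookup w k F.<? lookup w i ⌋ then ρ k +R (-R ρ i) else 1#

    inversion-factor : ∀ (i k : Fin n) → inversionTerm i k ≈ inversionFactor (toℕ i) (toℕ k)
    inversion-factor i k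
      rewrite sym (letter-toℕ w i) | sym (letter-toℕ w k) | sym (ext-toℕ ρ i) | sym (ext-toℕ ρ k)
      with toℕ k <? n
    ... | yes _ = ≈-refl
    ... | no k≮n = contradiction (FinP.toℕ<n k) k≮n

    -- Row i of the weight: the rhombi above bottom edge i contribute exactly the
    -- inversion factors (i , k); the shift by i only moves factors equal to 1.
    row-product : ∀ i → ∏< n (pieceWeight R ρ canonical i) ≈ ∏< n (inversionFactor i)
    row-product i = begin
      ∏< n (pieceWeight R ρ canonical i)    ≈⟨ ∏<-cong n (canonical-factor i) ⟩
      ∏< n (λ j → inversionFactor i (i + j)) ≈⟨ ∏<-shift i n (inversionFactor i)
                                                  (λ k k<i → reflexive (factor-below i k (<⇒≯ k<i)))
                                                  (λ k n≤k → reflexive (factor-beyond i k (≤⇒≯ n≤k))) ⟩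
      ∏< n (inversionFactor i)               ∎

    canonical-weight : weight R n ρ canonical ≈ inversionProduct R n ρ w
    canonical-weight = begin
      weight R n ρ canonical
        ≈⟨ prod-concatMap (λ i → map (pieceWeight R ρ canonical i) (upTo n)) (upTo n) ⟩
      prod R (map (λ i → prod R (map (pieceWeight R ρ canonical i) (upTo n))) (upTo n))
        ≡⟨ prod-upTo n _ ⟩
      ∏< n (λ i → prod R (map (pieceWeight R ρ canonical i) (upTo n)))
        ≈⟨ ∏<-cong n (λ i → reflexive (prod-upTo n _)) ⟩
      ∏< n (λ i → ∏< n (pieceWeight R ρ canonical i))
        ≈⟨ ∏<-cong n row-product ⟩
      ∏< n (λ i → ∏< n (inversionFactor i))
        ≈⟨ ≈-sym (prod-allFin _ _ (λ i → prod-allFin _ _ (inversion-factor i))) ⟩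
      prod R (map (λ i → prod R (map (inversionTerm i) (allFin n))) (allFin n))
        ≈⟨ ≈-sym (prod-concatMap (λ i → map (inversionTerm i) (allFin n)) (allFin n)) ⟩
      inversionProduct R n ρ w ∎

proposition5p4 : (a b n : ℕ) → a ≤ b → b ≤ n → (w : Vec (Fin 3) n) → Is012 a b n w →
    Σ Filling (λ P → IsPuzzle n w w w P
      × ((Q : Filling) → IsPuzzle n w w w Q → SameOn n P Q)
      × ((R : CommutativeRing 0ℓ 0ℓ) (ρ : Fin n → CommutativeRing.Carrier R) →
          CommutativeRing._≈_ R (weight R n ρ P) (inversionProduct R n ρ w)))
proposition5p4 a b n _ _ w _ =
  canonical ,
  canonical-isPuzzle ,
  Rigidity.canonical-unique w ,
  (λ R ρ → Weights.CanonicalWeight.canonical-weight R w ρ)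
  where open Canonical w
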